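{- Let $s\ge 1$ and let $G$ be a $k$-vertex orientation with $\alpha(G)\le s$. For a uniformly random permutation $\pi$ of $V(G)$, the probability that $G_\pi$ has no edges is at most $(se/k)^k$.
   Context: An orientation is a digraph with no directed cycle of length $2$. The independence number $\alpha(G)$ is that of the underlying undirected graph. For a permutation $\pi$ of the vertices of a digraph $G$, $G_\pi$ is the spanning subgraph of $G$ consisting of all edges $(u,v)$ of $G$ with $\pi(u)<\pi(v)$. -}

module Defs where

open import Data.Bool using (Bool; true; false; T)
open import Data.Nat using (ℕ; zero; suc; _+_; _*_; _≤_; _<_)
open import Data.Fin using (Fin; toℕ) renaming (_≟_ to _≟ᶠ_)
open import Data.Fin.Properties using (all?)
open import Data.Fin.Subset using (Subset; _∈_; ∣_∣)
open import Data.Vec using (Vec; []; _∷_; lookup)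
open import Data.List using (List; [_]; concatMap; map; filter; length; allFin)
open import Data.Product using (_×_)
open import Relation.Binary.PropositionalEquality using (_≡_)
open import Relation.Nullary using (¬_; Dec)
open import Relation.Nullary.Decidable using (_→-dec_; ¬?; _×-dec_)
open import Data.Bool.Properties using (T?)
import Data.Nat.Properties as ℕP

Digraph : ℕ → Set
Digraph k = Fin k → Fin k → Bool

-- Orientation: no directed cycle of length 2 (this also excludes loops).
IsOrientation : ∀ {k} → Digraph k → Set
IsOrientation {k} E = ∀ (u v : Fin k) → E u v ≡ true → E v u ≡ false

IsIndependent : ∀ {k} → Digraph k → Subset k → Set
IsIndependent {k} E S = ∀ (u v : Fin k) → u ∈ S → v ∈ S → E u v ≡ false

IndepNumberAtMost : ∀ {k} → Digraph k → ℕ → Set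
IndepNumberAtMost {k} E s = ∀ (S : Subset k) → IsIndependent E S → ∣ S ∣ ≤ s

allVecs : ∀ m k → List (Vec (Fin k) m)
allVecs zero k = [ [] ]
allVecs (suc m) k = concatMap (λ v → map (_∷ v) (allFin k)) (allVecs m k)

-- A vector π : Vec (Fin k) k encodes the map u ↦ lookup π u; it is a
-- permutation of Fin k iff it is injective.
IsPerm : ∀ {k} → Vec (Fin k) k → Set
IsPerm {k} π = ∀ (i j : Fin k) → lookup π i ≡ lookup π j → i ≡ j

isPerm? : ∀ {k} (π : Vec (Fin k) k) → Dec (IsPerm π)
isPerm? π = all? λ i → all? λ j → (lookup π i ≟ᶠ lookup π j) →-dec (i ≟ᶠ j)

allPerms : ∀ k → List (Vec (Fin k) k)
allPerms k = filter isPerm? (allVecs k k)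

GπEdgeless : ∀ {k} → Digraph k → Vec (Fin k) k → Set
GπEdgeless {k} E π = ∀ (u v : Fin k) → ¬ (T (E u v) × toℕ (lookup π u) < toℕ (lookup π v))

GπEdgeless? : ∀ {k} (E : Digraph k) (π : Vec (Fin k) k) → Dec (GπEdgeless E π)
GπEdgeless? E π = all? λ u → all? λ v →
  ¬? (T? (E u v) ×-dec (toℕ (lookup π u) ℕP.<? toℕ (lookup π v)))

edgelessCount : ∀ {k} → Digraph k → ℕ
edgelessCount {k} E = length (filter (GπEdgeless? E) (allPerms k))

-- eNum n = Σ_{j=0}^{n} n!/j!, so eNum n / n! = Σ_{j=0}^{n} 1/j! → e.
eNum : ℕ → ℕ
eNum zero = 1
eNum (suc n) = suc n * eNum n + 1

{-# OPTIONS --safe #-}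
module Submission where

-- If G_π has no edges then π(u) > π(v) for every edge (u, v), so the vertex in position t is a
-- source of the subgraph induced by the vertices in positions ≥ t. The sources of an induced
-- subgraph form an independent set; choosing the vertices from the last position backwards there
-- are thus at most s choices each time, so at most s^k permutations qualify.
-- For the factorial, let f(a) = a^a / a! and e_a = Σ_{i ≤ a} 1/i! = eNum a / a!. Then
-- f(a+1) = f(a) (1 + 1/a)^a, and (1 + 1/a)^a = Σ_i C(a,i) a^(-i) ≤ Σ_i 1/i! = e_a termwise,
-- since C(a,i) i! = a (a-1) ⋯ (a-i+1) ≤ a^i.
-- As e_a ≤ e_(a+1), induction gives f(k) ≤ e_k^k, so s^k / k! ≤ (s e_k / k)^k ≤ (s e / k)^k.

open import Defs
open import Data.Bool using (true; false; T)
open import Data.Bool.Properties using () renaming (_≟_ to _≟ᵇ_)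
open import Data.Empty using (⊥-elim)
open import Data.Fin as Fin using (Fin; toℕ; zero; suc; punchOut) renaming (_≟_ to _≟ᶠ_)
open import Data.Fin.Properties as FinP using (any?; all?; toℕ≤pred[n]; punchOut-injective; injective⇒≤)
open import Data.Fin.Subset using (∣_∣) renaming (_∈_ to _∈ˢ_)
open import Data.List as List using (List; []; _∷_; _++_; length; filter; map; allFin; cartesianProductWith)
open import Data.List.Properties using (filter-++; length-++; filter-none)
open import Data.List.Relation.Unary.All as All using (All; [])
import Data.List.Relation.Unary.All.Properties as AllP
open import Data.List.Relation.Unary.AllPairs using ([]; _∷_)
open import Data.List.Relation.Unary.Any using (here; there)
open import Data.List.Membership.Propositional using (_∈_)
open import Data.List.Membership.Propositional.Properties
  using (∈-∃++; ∈-++⁺ˡ; ∈-++⁺ʳ; ∈-++⁻; ∈-filter⁺; ∈-filter⁻; ∈-allFin; ∈-cartesianProductWith⁺)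
open import Data.List.Relation.Unary.Unique.Propositional using (Unique)
import Data.List.Relation.Unary.Unique.Propositional.Properties as Unique
open import Data.Nat using (ℕ; zero; suc; _+_; _*_; _∸_; _^_; _≤_; _!; z≤n; s≤s; NonZero)
open import Data.Nat.Combinatorics using (_C_; k>n⇒nCk≡0; nCk+nC[k+1]≡[n+1]C[k+1])
open import Data.Nat.Properties
open import Data.Nat.Solver using (module +-*-Solver)
open import Data.Product using (∃; ∃-syntax; _×_; _,_; proj₁; proj₂; swap)
open import Data.Sum using (inj₁; inj₂)
open import Data.Unit using (⊤; tt)
open import Data.Vec using (Vec; []; _∷_; lookup; tabulate)
open import Data.Vec.Functional using (Vector)
open import Data.Vec.Properties using (∷-injective; tabulate-cong; tabulate∘lookup; lookup∘tabulate; []=⇒lookup)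
import Data.Vec.Membership.DecPropositional as VecMembership
open import Data.Vec.Membership.Propositional.Properties using (∈-tabulate⁺)
open import Data.Vec.Relation.Unary.Any.Properties using (tabulate⁻)
open import Function using (_∘_; id; flip)
open import Level using (0ℓ)
open import Relation.Nullary using (¬_; yes; no; does)
open import Relation.Nullary.Decidable using (_×-dec_; ¬?; _→-dec_)
open import Relation.Unary using (Pred; Decidable)
open import Relation.Binary.PropositionalEquality
import Algebra.Properties.CommutativeSemigroup *-commutativeSemigroup as *-CS
import Algebra.Properties.CommutativeSemiring.Binomial +-*-commutativeSemiring as Binomial
import Algebra.Properties.CommutativeSemiring.Exp +-*-commutativeSemiring as Exp
import Algebra.Properties.Semiring.Mult +-*-semiring as Mult
open import Algebra.Properties.Semiring.Sum +-*-semiring using (sum; sum⁺-syntax; *-distribˡ-sum; *-distribʳ-sum)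

open +-*-Solver using (solve; _:=_; _:+_; _:*_; con)

^≡Exp^ : ∀ x n → x ^ n ≡ x Exp.^ n
^≡Exp^ x zero    = refl
^≡Exp^ x (suc n) = cong (x *_) (^≡Exp^ x n)

*≡Mult× : ∀ n x → n * x ≡ n Mult.× x
*≡Mult× zero    x = refl
*≡Mult× (suc n) x = cong (x +_) (*≡Mult× n x)

sum-mono-≤ : ∀ {n} {f g : Vector ℕ n} → (∀ i → f i ≤ g i) → sum f ≤ sum g
sum-mono-≤ {zero}  f≤g = z≤n
sum-mono-≤ {suc n} f≤g = +-mono-≤ (f≤g zero) (sum-mono-≤ (f≤g ∘ suc))

falling : ℕ → ℕ → ℕ
falling n       zero    = 1
falling zero    (suc i) = 0
falling (suc n) (suc i) = suc n * falling n i

falling-suc : ∀ n i → falling n (suc i) + suc i * falling n i ≡ suc n * falling n i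
falling-suc zero    zero    = refl
falling-suc zero    (suc i) = *-zeroʳ (suc (suc i))
falling-suc (suc n) zero    = solve 1 (λ n → (con 1 :+ n) :* con 1 :+ con 1 := (con 2 :+ n) :* con 1) refl n
falling-suc (suc n) (suc i) = begin
  suc n * falling n (suc i) + suc (suc i) * (suc n * falling n i)
    ≡⟨ solve 4 (λ n i f g → (con 1 :+ n) :* g :+ (con 2 :+ i) :* ((con 1 :+ n) :* f)
                          := (con 1 :+ n) :* ((g :+ (con 1 :+ i) :* f) :+ f))
             refl n i (falling n i) (falling n (suc i)) ⟩
  suc n * ((falling n (suc i) + suc i * falling n i) + falling n i)
    ≡⟨ cong (λ t → suc n * (t + falling n i)) (falling-suc n i) ⟩
  suc n * (suc n * falling n i + falling n i)
    ≡⟨ solve 2 (λ n f → (con 1 :+ n) :* ((con 1 :+ n) :* f :+ f) := (con 2 :+ n) :* ((con 1 :+ n) :* f))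
             refl n (falling n i) ⟩
  suc (suc n) * (suc n * falling n i) ∎
  where open ≡-Reasoning

C*!≡falling : ∀ n i → (n C i) * i ! ≡ falling n i
C*!≡falling n       zero    = refl
C*!≡falling zero    (suc i) = cong (_* suc i !) (k>n⇒nCk≡0 {0} {suc i} (s≤s z≤n))
C*!≡falling (suc n) (suc i) = begin
  (suc n C suc i) * suc i !                         ≡⟨ cong (_* suc i !) (nCk+nC[k+1]≡[n+1]C[k+1] n i) ⟨
  (n C i + n C suc i) * suc i !                     ≡⟨ *-distribʳ-+ (suc i !) (n C i) (n C suc i) ⟩
  (n C i) * (suc i * i !) + (n C suc i) * suc i !   ≡⟨ cong (_+ (n C suc i) * suc i !) (*-CS.x∙yz≈y∙xz (n C i) (suc i) (i !)) ⟩
  suc i * ((n C i) * i !) + (n C suc i) * suc i !   ≡⟨ cong₂ _+_ (cong (suc i *_) (C*!≡falling n i)) (C*!≡falling n (suc i)) ⟩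
  suc i * falling n i + falling n (suc i)           ≡⟨ +-comm (suc i * falling n i) _ ⟩
  falling n (suc i) + suc i * falling n i           ≡⟨ falling-suc n i ⟩
  suc n * falling n i                               ∎
  where open ≡-Reasoning

eNum≡∑falling : ∀ n → eNum n ≡ ∑[ i ≤ n ] falling n (toℕ i)
eNum≡∑falling zero    = refl
eNum≡∑falling (suc n) = begin
  suc n * eNum n + 1                                    ≡⟨ +-comm (suc n * eNum n) 1 ⟩
  1 + suc n * eNum n                                    ≡⟨ cong (λ t → 1 + suc n * t) (eNum≡∑falling n) ⟩
  1 + suc n * (∑[ i ≤ n ] falling n (toℕ i))            ≡⟨ cong (1 +_) (*-distribˡ-sum (suc n) (falling n ∘ toℕ {suc n})) ⟩
  1 + (∑[ i ≤ n ] (suc n * falling n (toℕ i)))          ∎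
  where open ≡-Reasoning

a^i*m!≤a^m*i! : ∀ {a i m} → i ≤ m → m ≤ a → a ^ i * m ! ≤ a ^ m * i !
a^i*m!≤a^m*i! {a} {i} {m} i≤m m≤a with m≤n⇒m<n∨m≡n i≤m
... | inj₂ refl = ≤-refl
a^i*m!≤a^m*i! {a} {i} {suc m} _ m<a | inj₁ (s≤s i≤m) = begin
  a ^ i * (suc m * m !)   ≡⟨ *-CS.x∙yz≈y∙xz (a ^ i) (suc m) (m !) ⟩
  suc m * (a ^ i * m !)   ≤⟨ *-mono-≤ m<a (a^i*m!≤a^m*i! i≤m (<⇒≤ m<a)) ⟩
  a * (a ^ m * i !)       ≡⟨ *-assoc a (a ^ m) (i !) ⟨
  a ^ suc m * i !         ∎
  where open ≤-Reasoning

^-distribʳ-* : ∀ x y n → (x * y) ^ n ≡ x ^ n * y ^ n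
^-distribʳ-* x y n = begin
  (x * y) ^ n            ≡⟨ ^≡Exp^ (x * y) n ⟩
  (x * y) Exp.^ n        ≡⟨ Exp.^-distrib-* x y n ⟩
  x Exp.^ n * y Exp.^ n  ≡⟨ cong₂ _*_ (^≡Exp^ x n) (^≡Exp^ y n) ⟨
  x ^ n * y ^ n          ∎
  where open ≡-Reasoning

binomialTerm[x,1] : ∀ x n (i : Fin (suc n)) → Binomial.binomialTerm x 1 n i ≡ (n C toℕ i) * x ^ toℕ i
binomialTerm[x,1] x n i = begin
  (n C j) Mult.× (x Exp.^ j * 1 Exp.^ (n ∸ j))  ≡⟨ *≡Mult× (n C j) _ ⟨
  (n C j) * (x Exp.^ j * 1 Exp.^ (n ∸ j))           ≡⟨ cong₂ (λ p q → (n C j) * (p * q)) (^≡Exp^ x j) (^≡Exp^ 1 (n ∸ j)) ⟨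
  (n C j) * (x ^ j * 1 ^ (n ∸ j))                   ≡⟨ cong (λ t → (n C j) * (x ^ j * t)) (^-zeroˡ (n ∸ j)) ⟩
  (n C j) * (x ^ j * 1)                             ≡⟨ cong ((n C j) *_) (*-identityʳ (x ^ j)) ⟩
  (n C j) * x ^ j                                   ∎
  where
  open ≡-Reasoning
  j = toℕ i

[1+a]^a*a!≤a^a*eNum[a] : ∀ a → suc a ^ a * a ! ≤ a ^ a * eNum a
[1+a]^a*a!≤a^a*eNum[a] a = begin
  suc a ^ a * a !                                    ≡⟨ cong (λ t → t ^ a * a !) (+-comm 1 a) ⟩
  (a + 1) ^ a * a !                                  ≡⟨ cong (_* a !) (trans (^≡Exp^ (a + 1) a) (Binomial.theorem a a 1)) ⟩
  Binomial.binomialExpansion a 1 a * a !             ≡⟨ *-distribʳ-sum (a !) (Binomial.binomialTerm a 1 a) ⟩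
  (∑[ i ≤ a ] (Binomial.binomialTerm a 1 a i * a !)) ≤⟨ sum-mono-≤ termwise ⟩
  (∑[ i ≤ a ] (a ^ a * falling a (toℕ i)))           ≡⟨ *-distribˡ-sum (a ^ a) (falling a ∘ toℕ {suc a}) ⟨
  a ^ a * (∑[ i ≤ a ] falling a (toℕ i))             ≡⟨ cong (a ^ a *_) (eNum≡∑falling a) ⟨
  a ^ a * eNum a                                     ∎
  where
  open ≤-Reasoning
  termwise : ∀ (i : Fin (suc a)) → Binomial.binomialTerm a 1 a i * a ! ≤ a ^ a * falling a (toℕ i)
  termwise i = begin
    Binomial.binomialTerm a 1 a i * a !  ≡⟨ cong (_* a !) (binomialTerm[x,1] a a i) ⟩
    (a C j) * a ^ j * a !                ≡⟨ *-assoc (a C j) (a ^ j) (a !) ⟩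
    (a C j) * (a ^ j * a !)              ≤⟨ *-monoʳ-≤ (a C j) (a^i*m!≤a^m*i! (toℕ≤pred[n] i) ≤-refl) ⟩
    (a C j) * (a ^ a * j !)              ≡⟨ *-CS.x∙yz≈y∙xz (a C j) (a ^ a) (j !) ⟩
    a ^ a * ((a C j) * j !)              ≡⟨ cong (a ^ a *_) (C*!≡falling a j) ⟩
    a ^ a * falling a j                  ∎
    where j = toℕ i

a^a≢0 : ∀ a → NonZero (a ^ a)
a^a≢0 zero    = _
a^a≢0 (suc a) = m^n≢0 (suc a) (suc a)

a^a*[a!]^a≤a!*eNum[a]^a : ∀ a → a ^ a * (a !) ^ a ≤ a ! * eNum a ^ a
a^a*[a!]^a≤a!*eNum[a]^a zero    = ≤-refl
a^a*[a!]^a≤a!*eNum[a]^a (suc a) = begin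
  b ^ b * (b * F) ^ b         ≡⟨ cong (b ^ b *_) (^-distribʳ-* b F b) ⟩
  (b * U) * (b ^ b * F ^ b)   ≡⟨ solve 4 (λ b U B G → (b :* U) :* (B :* G) := b :* (B :* (U :* G)))
                                         refl b U (b ^ b) (F ^ b) ⟩
  b * (b ^ b * (U * F ^ b))   ≤⟨ *-monoʳ-≤ b (*-monoʳ-≤ (b ^ b) f[1+a]≤e[a]^[1+a]) ⟩
  b * (b ^ b * (F * E ^ b))   ≡⟨ solve 4 (λ b B F H → b :* (B :* (F :* H)) := (b :* F) :* (B :* H))
                                         refl b (b ^ b) F (E ^ b) ⟩
  (b * F) * (b ^ b * E ^ b)   ≡⟨ cong ((b * F) *_) (^-distribʳ-* b E b) ⟨
  (b * F) * (b * E) ^ b       ≤⟨ *-monoʳ-≤ (b * F) (^-monoˡ-≤ b (m≤m+n (b * E) 1)) ⟩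
  (b * F) * eNum b ^ b        ∎
  where
  open ≤-Reasoning
  b = suc a
  F = a !
  E = eNum a
  U = b ^ a
  Q = a ^ a
  instance
    Q≢0 : NonZero Q
    Q≢0 = a^a≢0 a
  -- f(a+1) ≤ e_a^(a+1), multiplied out
  f[1+a]≤e[a]^[1+a] : U * F ^ b ≤ F * E ^ b
  f[1+a]≤e[a]^[1+a] = *-cancelˡ-≤ Q (begin
    Q * (U * (F * F ^ a))    ≡⟨ solve 4 (λ Q U F G → Q :* (U :* (F :* G)) := (U :* F) :* (Q :* G)) refl Q U F (F ^ a) ⟩
    (U * F) * (Q * F ^ a)    ≤⟨ *-mono-≤ ([1+a]^a*a!≤a^a*eNum[a] a) (a^a*[a!]^a≤a!*eNum[a]^a a) ⟩
    (Q * E) * (F * E ^ a)    ≡⟨ solve 4 (λ Q E F H → (Q :* E) :* (F :* H) := Q :* (F :* (E :* H))) refl Q E F (E ^ a) ⟩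
    Q * (F * (E * E ^ a))    ∎)

injectiveOn⇒length≤ : ∀ {A B : Set} (f : A → B) {xs : List A} {ys : List B} → Unique xs →
                      (∀ {x} → x ∈ xs → f x ∈ ys) →
                      (∀ {x y} → x ∈ xs → y ∈ xs → f x ≡ f y → x ≡ y) →
                      length xs ≤ length ys
injectiveOn⇒length≤ f {[]}     _              _     _   = z≤n
injectiveOn⇒length≤ f {x ∷ xs} (x∉xs ∷ xs-uniq) f∈ys f-inj with ∈-∃++ (f∈ys (here refl))
... | ys₁ , ys₂ , refl = begin
  suc (length xs)                ≤⟨ s≤s (injectiveOn⇒length≤ f xs-uniq f∈ys₁++ys₂ (λ p q → f-inj (there p) (there q))) ⟩
  suc (length (ys₁ ++ ys₂))      ≡⟨ cong suc (length-++ ys₁) ⟩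
  suc (length ys₁ + length ys₂)  ≡⟨ +-suc (length ys₁) (length ys₂) ⟨
  length ys₁ + length (f x ∷ ys₂) ≡⟨ length-++ ys₁ ⟨
  length (ys₁ ++ f x ∷ ys₂)      ∎
  where
  open ≤-Reasoning
  f∈ys₁++ys₂ : ∀ {z} → z ∈ xs → f z ∈ ys₁ ++ ys₂
  f∈ys₁++ys₂ z∈xs with ∈-++⁻ ys₁ (f∈ys (there z∈xs))
  ... | inj₁ p         = ∈-++⁺ˡ p
  ... | inj₂ (here eq) = ⊥-elim (All.lookup x∉xs z∈xs (f-inj (here refl) (there z∈xs) (sym eq)))
  ... | inj₂ (there p) = ∈-++⁺ʳ ys₁ p

concatMap-map≡cartesianProductWith : ∀ {X Y Z : Set} (f : X → Y → Z) xs ys →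
  List.concatMap (λ x → map (f x) ys) xs ≡ cartesianProductWith f xs ys
concatMap-map≡cartesianProductWith f []       ys = refl
concatMap-map≡cartesianProductWith f (x ∷ xs) ys = cong (map (f x) ys ++_) (concatMap-map≡cartesianProductWith f xs ys)

allVecs-suc : ∀ m k → allVecs (suc m) k ≡ cartesianProductWith (flip _∷_) (allVecs m k) (allFin k)
allVecs-suc m k = concatMap-map≡cartesianProductWith (flip _∷_) (allVecs m k) (allFin k)

∈-allVecs : ∀ {m k} (v : Vec (Fin k) m) → v ∈ allVecs m k
∈-allVecs         []      = here refl
∈-allVecs {suc m} {k} (x ∷ v) =
  subst (x ∷ v ∈_) (sym (allVecs-suc m k)) (∈-cartesianProductWith⁺ (flip _∷_) (∈-allVecs v) (∈-allFin x))

allVecs-unique : ∀ m k → Unique (allVecs m k)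
allVecs-unique zero    k = [] ∷ []
allVecs-unique (suc m) k = subst Unique (sym (allVecs-suc m k))
  (Unique.cartesianProductWith⁺ (flip _∷_) (swap ∘ ∷-injective) (allVecs-unique m k) (Unique.allFin⁺ k))

module _ {Z : Set} {P : Pred Z 0ℓ} (P? : Decidable P) where

  length-filter-++ : ∀ us vs → length (filter P? (us ++ vs)) ≡ length (filter P? us) + length (filter P? vs)
  length-filter-++ us vs = trans (cong length (filter-++ P? us vs)) (length-++ (filter P? us))

  length-filter-map≤ : ∀ {Y : Set} {R : Pred Y 0ℓ} (R? : Decidable R) (g : Y → Z) →
                       (∀ {y} → P (g y) → R y) → ∀ ys →
                       length (filter P? (map g ys)) ≤ length (filter R? ys)
  length-filter-map≤ R? g P⇒R []       = z≤n
  length-filter-map≤ R? g P⇒R (y ∷ ys) with P? (g y) | R? y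
  ... | yes _  | yes _  = s≤s (length-filter-map≤ R? g P⇒R ys)
  ... | yes p  | no ¬r  = ⊥-elim (¬r (P⇒R p))
  ... | no  _  | yes _  = m≤n⇒m≤1+n (length-filter-map≤ R? g P⇒R ys)
  ... | no  _  | no  _  = length-filter-map≤ R? g P⇒R ys

  length-filter-cartesianProductWith≤ :
    ∀ {X Y : Set} {Q : Pred X 0ℓ} (Q? : Decidable Q) (f : X → Y → Z) {s} ys →
    (∀ {x y} → P (f x y) → Q x) →
    (∀ x → Q x → length (filter P? (map (f x) ys)) ≤ s) → ∀ xs →
    length (filter P? (cartesianProductWith f xs ys)) ≤ s * length (filter Q? xs)
  length-filter-cartesianProductWith≤ Q? f ys P⇒Q fibre≤s []       = z≤n
  length-filter-cartesianProductWith≤ Q? f {s} ys P⇒Q fibre≤s (x ∷ xs) with Q? x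
  ... | yes q = begin
    length (filter P? (map (f x) ys ++ rest))   ≡⟨ length-filter-++ (map (f x) ys) rest ⟩
    length (filter P? (map (f x) ys)) + length (filter P? rest)
                                                ≤⟨ +-mono-≤ (fibre≤s x q) ih ⟩
    s + s * length (filter Q? xs)               ≡⟨ *-suc s _ ⟨
    s * suc (length (filter Q? xs))             ∎
    where
    open ≤-Reasoning
    rest = cartesianProductWith f xs ys
    ih = length-filter-cartesianProductWith≤ Q? f ys P⇒Q fibre≤s xs
  ... | no ¬q = begin
    length (filter P? (map (f x) ys ++ rest))   ≡⟨ length-filter-++ (map (f x) ys) rest ⟩
    length (filter P? (map (f x) ys)) + length (filter P? rest)
                                                ≡⟨ cong (λ l → length l + length (filter P? rest)) (filter-none P? fibre-empty) ⟩
    length (filter P? rest)                     ≤⟨ ih ⟩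
    s * length (filter Q? xs)                   ∎
    where
    open ≤-Reasoning
    rest = cartesianProductWith f xs ys
    ih = length-filter-cartesianProductWith≤ Q? f ys P⇒Q fibre≤s xs
    fibre-empty : All (¬_ ∘ P) (map (f x) ys)
    fibre-empty = AllP.map⁺ (All.universal (λ y → ¬q ∘ P⇒Q) ys)

∣tabulate∣≡length-filter : ∀ {A : Set} {P : Pred A 0ℓ} (P? : Decidable P) {n} (g : Fin n → A) →
                           ∣ tabulate (does ∘ P? ∘ g) ∣ ≡ length (filter P? (List.tabulate g))
∣tabulate∣≡length-filter P? {zero}  g = refl
∣tabulate∣≡length-filter P? {suc n} g with P? (g zero)
... | yes _ = cong suc (∣tabulate∣≡length-filter P? (g ∘ suc))
... | no  _ = ∣tabulate∣≡length-filter P? (g ∘ suc)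

∈-tabulate-does⁻ : ∀ {n} {P : Pred (Fin n) 0ℓ} (P? : Decidable P) {i} → i ∈ˢ tabulate (does ∘ P?) → P i
∈-tabulate-does⁻ P? {i} i∈ with P? i | trans (sym (lookup∘tabulate (does ∘ P?) i)) ([]=⇒lookup i∈)
... | yes p | _  = p
... | no  _ | ()

IsPerm⇒surjective : ∀ {k} (π : Vec (Fin k) k) → IsPerm π → ∀ t → ∃ λ u → lookup π u ≡ t
IsPerm⇒surjective {suc n} π π-inj t with any? (λ u → lookup π u ≟ᶠ t)
... | yes found = found
... | no  missed = ⊥-elim (1+n≰n (injective⇒≤ punched-inj))
  where
  t≢π : ∀ u → t ≢ lookup π u
  t≢π u t≡πu = missed (u , sym t≡πu)
  punched : Fin (suc n) → Fin n
  punched u = punchOut (t≢π u)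
  punched-inj : ∀ {u v} → punched u ≡ punched v → u ≡ v
  punched-inj {u} {v} eq = π-inj u v (punchOut-injective (t≢π u) (t≢π v) eq)

module _ {k : ℕ} (π : Vec (Fin k) k) where

  inverse : Fin k → Fin k
  inverse t with any? (λ u → lookup π u ≟ᶠ t)
  ... | yes (u , _) = u
  ... | no  _       = t   -- junk; unreachable when π is a permutation

  lookup∘inverse : IsPerm π → ∀ t → lookup π (inverse t) ≡ t
  lookup∘inverse π-inj t with any? (λ u → lookup π u ≟ᶠ t)
  ... | yes (_ , πu≡t) = πu≡t
  ... | no  missed     = ⊥-elim (missed (IsPerm⇒surjective π π-inj t))

  inverse∘lookup : IsPerm π → ∀ u → inverse (lookup π u) ≡ u
  inverse∘lookup π-inj u = π-inj _ _ (lookup∘inverse π-inj (lookup π u))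

invert : ∀ {k} → Vec (Fin k) k → Vec (Fin k) k
invert π = tabulate (inverse π)

invert-injective : ∀ {k} {π σ : Vec (Fin k) k} → IsPerm π → IsPerm σ → invert π ≡ invert σ → π ≡ σ
invert-injective {π = π} {σ} π-inj σ-inj eq = begin
  π                        ≡⟨ tabulate∘lookup π ⟨
  tabulate (lookup π)      ≡⟨ tabulate-cong π≗σ ⟩
  tabulate (lookup σ)      ≡⟨ tabulate∘lookup σ ⟩
  σ                        ∎
  where
  open ≡-Reasoning
  inverses-agree : ∀ t → inverse π t ≡ inverse σ t
  inverses-agree t = trans (sym (lookup∘tabulate (inverse π) t))
                           (trans (cong (λ v → lookup v t) eq) (lookup∘tabulate (inverse σ) t))
  π≗σ : ∀ u → lookup π u ≡ lookup σ u
  π≗σ u = begin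
    lookup π u                          ≡⟨ lookup∘inverse σ σ-inj (lookup π u) ⟨
    lookup σ (inverse σ (lookup π u))   ≡⟨ cong (lookup σ) (inverses-agree (lookup π u)) ⟨
    lookup σ (inverse π (lookup π u))   ≡⟨ cong (lookup σ) (inverse∘lookup π π-inj u) ⟩
    lookup σ u                          ∎

module _ {k : ℕ} (E : Digraph k) where

  open VecMembership (_≟ᶠ_ {k}) using () renaming (_∈_ to _∈ᵥ_; _∉_ to _∉ᵥ_; _∈?_ to _∈ᵥ?_)

  IsSourceOutside : ∀ {m} → Vec (Fin k) m → Fin k → Set
  IsSourceOutside τ x = x ∉ᵥ τ × (∀ u → E u x ≡ true → u ∈ᵥ τ)

  isSourceOutside? : ∀ {m} (τ : Vec (Fin k) m) → Decidable (IsSourceOutside τ)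
  isSourceOutside? τ x = ¬? (x ∈ᵥ? τ) ×-dec all? (λ u → (E u x ≟ᵇ true) →-dec (u ∈ᵥ? τ))

  IsSourceSequence : ∀ {m} → Vec (Fin k) m → Set
  IsSourceSequence []      = ⊤
  IsSourceSequence (x ∷ τ) = IsSourceOutside τ x × IsSourceSequence τ

  isSourceSequence? : ∀ {m} → Decidable (IsSourceSequence {m})
  isSourceSequence? []      = yes tt
  isSourceSequence? (x ∷ τ) = isSourceOutside? τ x ×-dec isSourceSequence? τ

  sourcesOutside-independent : ∀ {m} (τ : Vec (Fin k) m) → IsIndependent E (tabulate (does ∘ isSourceOutside? τ))
  sourcesOutside-independent τ u v u∈ v∈ with E u v in uv
  ... | false = refl
  ... | true  = ⊥-elim (proj₁ (∈-tabulate-does⁻ (isSourceOutside? τ) u∈)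
                               (proj₂ (∈-tabulate-does⁻ (isSourceOutside? τ) v∈) u uv))

  module _ {s : ℕ} (α≤s : IndepNumberAtMost E s) where

    #sourcesOutside≤ : ∀ {m} (τ : Vec (Fin k) m) → length (filter (isSourceOutside? τ) (allFin k)) ≤ s
    #sourcesOutside≤ τ = subst (_≤ s) (∣tabulate∣≡length-filter (isSourceOutside? τ) id)
                               (α≤s _ (sourcesOutside-independent τ))

    #sourceSequences≤ : ∀ m → length (filter isSourceSequence? (allVecs m k)) ≤ s ^ m
    #sourceSequences≤ zero    = ≤-refl
    #sourceSequences≤ (suc m) = begin
      length (filter isSourceSequence? (allVecs (suc m) k))
        ≡⟨ cong (length ∘ filter isSourceSequence?) (allVecs-suc m k) ⟩
      length (filter isSourceSequence? (cartesianProductWith (flip _∷_) (allVecs m k) (allFin k)))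
        ≤⟨ length-filter-cartesianProductWith≤ isSourceSequence? isSourceSequence? (flip _∷_) (allFin k)
             proj₂ fibre≤s (allVecs m k) ⟩
      s * length (filter isSourceSequence? (allVecs m k))
        ≤⟨ *-monoʳ-≤ s (#sourceSequences≤ m) ⟩
      s * s ^ m
        ∎
      where
      open ≤-Reasoning
      fibre≤s : ∀ τ → IsSourceSequence τ → length (filter isSourceSequence? (map (_∷ τ) (allFin k))) ≤ s
      fibre≤s τ _ = ≤-trans (length-filter-map≤ isSourceSequence? (isSourceOutside? τ) (_∷ τ) proj₁ (allFin k))
                            (#sourcesOutside≤ τ)

  tabulate-isSourceSequence : ∀ {m} (g : Fin m → Fin k) → (∀ {i j} → g i ≡ g j → i ≡ j) →
                              (∀ i u → E u (g i) ≡ true → ∃ λ j → i Fin.< j × g j ≡ u) →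
                              IsSourceSequence (tabulate g)
  tabulate-isSourceSequence {zero}  g g-inj later = tt
  tabulate-isSourceSequence {suc m} g g-inj later =
    (g₀∉ , in-neighbours-later) , tabulate-isSourceSequence (g ∘ suc) (FinP.suc-injective ∘ g-inj) later′
    where
    g₀∉ : g zero ∉ᵥ tabulate (g ∘ suc)
    g₀∉ g₀∈ with tabulate⁻ g₀∈
    ... | i , g₀≡gᵢ₊₁ with g-inj g₀≡gᵢ₊₁
    ... | ()
    in-neighbours-later : ∀ u → E u (g zero) ≡ true → u ∈ᵥ tabulate (g ∘ suc)
    in-neighbours-later u uv with later zero u uv
    ... | suc j , _ , refl = ∈-tabulate⁺ (g ∘ suc) j
    later′ : ∀ i u → E u (g (suc i)) ≡ true → ∃ λ j → i Fin.< j × g (suc j) ≡ u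
    later′ i u uv with later (suc i) u uv
    ... | suc j , s≤s i<j , gⱼ≡u = j , i<j , gⱼ≡u

  invert-isSourceSequence : IsOrientation E → ∀ π → IsPerm π → GπEdgeless E π → IsSourceSequence (invert π)
  invert-isSourceSequence orient π π-inj edgeless = tabulate-isSourceSequence (inverse π) inverse-inj later
    where
    inverse-inj : ∀ {t t′} → inverse π t ≡ inverse π t′ → t ≡ t′
    inverse-inj {t} {t′} eq =
      trans (sym (lookup∘inverse π π-inj t)) (trans (cong (lookup π) eq) (lookup∘inverse π π-inj t′))
    later : ∀ t u → E u (inverse π t) ≡ true → ∃ λ j → t Fin.< j × inverse π j ≡ u
    later t u uw = lookup π u , FinP.≤∧≢⇒< (≮⇒≥ πu≮t) t≢πu , inverse∘lookup π π-inj u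
      where
      w = inverse π t
      πw≡t = lookup∘inverse π π-inj t
      πu≮t : ¬ (lookup π u Fin.< t)
      πu≮t πu<t = edgeless u w (subst T (sym uw) tt , subst (lookup π u Fin.<_) (sym πw≡t) πu<t)
      -- otherwise u = w and (u, w) would be a loop, which an orientation excludes
      t≢πu : t ≢ lookup π u
      t≢πu t≡πu with π-inj u w (trans (sym t≡πu) (sym πw≡t))
      ... | refl with trans (sym uw) (orient w w uw)
      ... | ()

  edgelessCount≤s^k : IsOrientation E → ∀ {s} → IndepNumberAtMost E s → edgelessCount E ≤ s ^ k
  edgelessCount≤s^k orient α≤s =
    ≤-trans (injectiveOn⇒length≤ invert edgelessPerms-unique invert-into invert-inj) (#sourceSequences≤ α≤s k)
    where
    edgelessPerms = filter (GπEdgeless? E) (allPerms k)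
    edgelessPerms-unique : Unique edgelessPerms
    edgelessPerms-unique = Unique.filter⁺ (GπEdgeless? E) (Unique.filter⁺ isPerm? (allVecs-unique k k))
    perm×edgeless : ∀ {π} → π ∈ edgelessPerms → IsPerm π × GπEdgeless E π
    perm×edgeless π∈ with ∈-filter⁻ (GπEdgeless? E) {xs = allPerms k} π∈
    ... | π∈perms , edgeless = proj₂ (∈-filter⁻ isPerm? {xs = allVecs k k} π∈perms) , edgeless
    invert-into : ∀ {π} → π ∈ edgelessPerms → invert π ∈ filter isSourceSequence? (allVecs k k)
    invert-into {π} π∈ with perm×edgeless π∈
    ... | π-inj , edgeless =
      ∈-filter⁺ isSourceSequence? (∈-allVecs (invert π)) (invert-isSourceSequence orient π π-inj edgeless)
    invert-inj : ∀ {π σ} → π ∈ edgelessPerms → σ ∈ edgelessPerms → invert π ≡ invert σ → π ≡ σ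
    invert-inj π∈ σ∈ = invert-injective (proj₁ (perm×edgeless π∈)) (proj₁ (perm×edgeless σ∈))


lemma2p2 : (s k : ℕ) → 1 ≤ s → (E : Digraph k) → IsOrientation E →
    IndepNumberAtMost E s →
    ∃[ n ] (edgelessCount E * k ^ k * (n !) ^ k ≤ k ! * s ^ k * eNum n ^ k)
lemma2p2 s k _ E orient α≤s = k , (begin
  edgelessCount E * k ^ k * (k !) ^ k    ≡⟨ *-assoc (edgelessCount E) (k ^ k) ((k !) ^ k) ⟩
  edgelessCount E * (k ^ k * (k !) ^ k)  ≤⟨ *-mono-≤ (edgelessCount≤s^k E orient α≤s) (a^a*[a!]^a≤a!*eNum[a]^a k) ⟩
  s ^ k * (k ! * eNum k ^ k)             ≡⟨ *-CS.x∙yz≈yx∙z (s ^ k) (k !) (eNum k ^ k) ⟩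
  k ! * s ^ k * eNum k ^ k               ∎)
  where open ≤-Reasoning
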